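{- Let $a,b,c$ be positive integers such that: none of $a,b,c$ is a perfect power; $a,b,c$ are pairwise coprime; $a\equiv-1\pmod 4$ or $b\equiv -1\pmod 4$; $\max\{a,b\}\ge 11$; $18\le\max\{a,b,c\}\le 10^{62}$; $c$ is even and $c>2$. Put $\alpha=\min\{\nu_2(a^2-1)-1,\nu_2(b^2-1)-1\}$ and $\beta=\nu_2(c)$. Suppose the equation $a^x+b^y=c^z$ has three distinct solutions $(x_t,y_t,z_t)$, $t=1,2,3$, in positive integers, labelled so that $z_1\le z_2\le z_3$. If for some pair $\{I,J\}\subset\{1,2,3\}$ one has $x_I\not\equiv x_J\pmod 2$ or $y_I\not\equiv y_J\pmod 2$, then either $(\beta,z_1)=(1,1)$ or $z_1=\alpha/\beta$.
   Context: A perfect power means $n^k$ with integers $n\ge1$, $k\ge2$. $\nu_2(A)$ is the exponent of $2$ in the nonzero integer $A$. -}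

module Defs where

open import Data.Nat using (ℕ; _^_; _≤_; _*_; _+_; suc)
open import Data.Nat.Divisibility using (_∣_)
open import Data.Product using (∃₂; _×_)
open import Relation.Nullary using (¬_)
open import Relation.Binary.PropositionalEquality using (_≡_)

IsPerfectPower : ℕ → Set
IsPerfectPower m = ∃₂ λ n k → 1 ≤ n × 2 ≤ k × m ≡ n ^ k

-- Val2 A e  means  ν₂(A) = e  (for A ≠ 0): 2^e ∣ A and 2^(e+1) ∤ A
Val2 : ℕ → ℕ → Set
Val2 A e = (2 ^ e ∣ A) × ¬ (2 ^ suc e ∣ A)

module Submission where

-- Since c is even, a and b are odd. Let N = min(ν₂(a² − 1), ν₂(b² − 1)) − 1 and m = 2^(N+1).
-- As a² ≡ b² ≡ 1 (mod m), a^x + b^y is congruent mod m to 2, a + 1, b + 1 or a + b according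
-- to the parities of x and y. Now m ∤ 2, and m divides at most one of a + 1, b + 1, a + b:
-- otherwise it divides one of a ± 1 and one of b ± 1, and then 2^(N+2) divides both a² − 1 and
-- b² − 1. So if ν₂(c^z₁) = z₁β exceeded N, the three solutions would share the parities of
-- their exponents. If instead z₁β ≥ 2, then 4 divides the relevant residue, which forces
-- 2^N to divide it, so z₁β ≥ N.

open import Defs
open import Data.Nat using (ℕ; zero; suc; _+_; _*_; _∸_; _^_; _≤_; _<_; _⊔_; _⊓_; _%_; s≤s)
open import Data.Nat.Properties
open import Data.Nat.DivMod using (_/_; m≡m%n+[m/n]*n; m%n<n)
open import Data.Nat.Divisibility
open import Data.Nat.Primality using (euclidsLemma; prime[2])
open import Data.Nat.Coprimality using (Coprime)
open import Data.Nat.Tactic.RingSolver using (solve-∀)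
open import Data.Product using (_×_; _,_; ∃; proj₁)
open import Data.Sum using (_⊎_; inj₁; inj₂; [_,_]′)
open import Data.Empty using (⊥; ⊥-elim)
open import Relation.Binary.PropositionalEquality
open import Relation.Nullary using (¬_; yes; no)

4∤2 : ¬ 4 ∣ 2
4∤2 4∣2 with ∣⇒≤ 4∣2
... | s≤s (s≤s ())

2∤1 : ¬ 2 ∣ 1
2∤1 2∣1 with ∣1⇒≡1 2∣1
... | ()

m^n∣m^o : ∀ m {n o} → n ≤ o → m ^ n ∣ m ^ o
m^n∣m^o m {n} n≤o = subst (λ k → m ^ n ∣ m ^ k) (m+[n∸m]≡n n≤o)
  (subst (m ^ n ∣_) (sym (^-distribˡ-+-* m n _)) (m∣m*n _))

2∤m⇒2^k∣m*o⇒2^k∣o : ∀ k {m o} → ¬ 2 ∣ m → 2 ^ k ∣ m * o → 2 ^ k ∣ o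
2∤m⇒2^k∣m*o⇒2^k∣o zero {o = o} _ _ = 1∣ o
2∤m⇒2^k∣m*o⇒2^k∣o (suc k) {m} {o} 2∤m 2^[1+k]∣mo
  with euclidsLemma m o prime[2] (∣-trans (m∣m*n (2 ^ k)) 2^[1+k]∣mo)
... | inj₁ 2∣m = ⊥-elim (2∤m 2∣m)
... | inj₂ (divides o′ refl) = subst (2 ^ suc k ∣_) (*-comm 2 o′)
  (*-monoʳ-∣ 2 (2∤m⇒2^k∣m*o⇒2^k∣o k 2∤m
    (*-cancelˡ-∣ 2 (subst (2 ^ suc k ∣_) (regroup m o′) 2^[1+k]∣mo))))
  where
  regroup : ∀ m o′ → m * (o′ * 2) ≡ 2 * (m * o′)
  regroup = solve-∀

4∤m⇒2^[1+k]∣m*o⇒2^k∣o : ∀ k {m o} → ¬ 4 ∣ m → 2 ^ suc k ∣ m * o → 2 ^ k ∣ o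
4∤m⇒2^[1+k]∣m*o⇒2^k∣o k {m} {o} 4∤m h with 2 ∣? m
... | no 2∤m = ∣-trans (m^n∣m^o 2 (n≤1+n k)) (2∤m⇒2^k∣m*o⇒2^k∣o (suc k) 2∤m h)
... | yes (divides m′ refl) = 2∤m⇒2^k∣m*o⇒2^k∣o k {m′} (λ 2∣m′ → 4∤m (*-monoˡ-∣ 2 2∣m′))
  (*-cancelˡ-∣ 2 (subst (2 ^ suc k ∣_) (regroup m′ o) h))
  where
  regroup : ∀ m′ o → m′ * 2 * o ≡ 2 * (m′ * o)
  regroup = solve-∀

Val2-1 : Val2 1 0
Val2-1 = ∣-refl , 2∤1

Val2-2 : Val2 2 1
Val2-2 = ∣-refl , 4∤2

Val2⇒2^∣ : ∀ {A e k} → Val2 A e → k ≤ e → 2 ^ k ∣ A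
Val2⇒2^∣ (2^e∣A , _) k≤e = ∣-trans (m^n∣m^o 2 k≤e) 2^e∣A

Val2⇒≤ : ∀ {A e k} → Val2 A e → 2 ^ k ∣ A → k ≤ e
Val2⇒≤ {e = e} {k} (_ , 2^[1+e]∤A) 2^k∣A with k ≤? e
... | yes k≤e = k≤e
... | no k≰e = ⊥-elim (2^[1+e]∤A (∣-trans (m^n∣m^o 2 (≰⇒> k≰e)) 2^k∣A))

Val2⇒odd-part : ∀ {A e} → Val2 A e → ∃ λ d → A ≡ d * 2 ^ e × ¬ 2 ∣ d
Val2⇒odd-part {e = e} (divides d refl , 2^[1+e]∤A) =
  d , refl , λ 2∣d → 2^[1+e]∤A (*-monoˡ-∣ (2 ^ e) 2∣d)

Val2-* : ∀ {A B e f} → Val2 A e → Val2 B f → Val2 (A * B) (e + f)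
Val2-* {A} {B} {e} {f} νA νB with Val2⇒odd-part {A} {e} νA | Val2⇒odd-part {B} {f} νB
... | d , refl , 2∤d | d′ , refl , 2∤d′ =
  subst (_∣ d * 2 ^ e * (d′ * 2 ^ f)) (sym (^-distribˡ-+-* 2 e f)) (*-pres-∣ (proj₁ νA) (proj₁ νB)) ,
  λ 2^[1+e+f]∣AB → [ 2∤d , 2∤d′ ]′ (euclidsLemma d d′ prime[2]
    (*-cancelʳ-∣ (2 ^ (e + f)) {{m^n≢0 2 (e + f)}} (subst (2 ^ suc (e + f) ∣_) regroup 2^[1+e+f]∣AB)))
  where
  regroup : d * 2 ^ e * (d′ * 2 ^ f) ≡ d * d′ * 2 ^ (e + f)
  regroup = trans ([m*n]*[o*p]≡[m*o]*[n*p] d (2 ^ e) d′ (2 ^ f))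
                  (cong (d * d′ *_) (sym (^-distribˡ-+-* 2 e f)))

Val2-^ : ∀ {c β} → Val2 c β → ∀ z → Val2 (c ^ z) (z * β)
Val2-^ νc zero = Val2-1
Val2-^ {c} {β} νc (suc z) = Val2-* {c} {c ^ z} {β} {z * β} νc (Val2-^ νc z)

infix 4 _≡_[mod_]
_≡_[mod_] : ℕ → ℕ → ℕ → Set
S ≡ r [mod m ] = ∃ λ k → S ≡ r + k * m

+-≡[mod] : ∀ {m S T r s} → S ≡ r [mod m ] → T ≡ s [mod m ] → S + T ≡ r + s [mod m ]
+-≡[mod] {m} {r = r} {s} (k , refl) (l , refl) = k + l , regroup r s k l m
  where
  regroup : ∀ r s k l m → r + k * m + (s + l * m) ≡ r + s + (k + l) * m
  regroup = solve-∀

*-≡[mod] : ∀ {m S T r s} → S ≡ r [mod m ] → T ≡ s [mod m ] → S * T ≡ r * s [mod m ]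
*-≡[mod] {m} {r = r} {s} (k , refl) (l , refl) = r * l + k * s + k * l * m , regroup r s k l m
  where
  regroup : ∀ r s k l m → (r + k * m) * (s + l * m) ≡ r * s + (r * l + k * s + k * l * m) * m
  regroup = solve-∀

^≡^%2 : ∀ {m a} → a * a ≡ 1 [mod m ] → ∀ x → a ^ x ≡ a ^ (x % 2) [mod m ]
^≡^%2 _ zero = 0 , refl
^≡^%2 _ (suc zero) = 0 , sym (+-identityʳ _)
^≡^%2 {m} {a} a²≡1 (suc (suc x)) =
  subst₂ (_≡_[mod m ]) (*-assoc a a (a ^ x)) (*-identityˡ (a ^ (x % 2))) (*-≡[mod] a²≡1 (^≡^%2 a²≡1 x))

≡[mod]∧∣⇒∣ : ∀ {d m S r} → d ∣ m → S ≡ r [mod m ] → d ∣ S → d ∣ r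
≡[mod]∧∣⇒∣ {d} {m} {r = r} d∣m (k , refl) d∣S =
  ∣m+n∣m⇒∣n (subst (d ∣_) (+-comm r (k * m)) d∣S) (∣n⇒∣m*n k d∣m)

≡[mod]∧∣⇐∣ : ∀ {d m S r} → d ∣ m → S ≡ r [mod m ] → d ∣ r → d ∣ S
≡[mod]∧∣⇐∣ d∣m (k , refl) d∣r = ∣m∣n⇒∣m+n d∣r (∣n⇒∣m*n k d∣m)

coprime∧2∣⇒2∤ : ∀ {a c} → Coprime a c → 2 ∣ c → ¬ 2 ∣ a
coprime∧2∣⇒2∤ a⊥c 2∣c 2∣a with a⊥c (2∣a , 2∣c)
... | ()

2∤⇒suc-even : ∀ a → ¬ 2 ∣ a → ∃ λ n → a ≡ suc n × 2 ∣ n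
2∤⇒suc-even a 2∤a with a % 2 | m%n<n a 2 | m≡m%n+[m/n]*n a 2
... | 0 | _ | a≡ = ⊥-elim (2∤a (divides (a / 2) a≡))
... | 1 | _ | a≡ = a / 2 * 2 , a≡ , n∣m*n (a / 2)
... | suc (suc _) | s≤s (s≤s ()) | _

[1+n]²≡1+n*[2+n] : ∀ n → suc n * suc n ≡ 1 + n * (2 + n)
[1+n]²≡1+n*[2+n] = solve-∀

2∣⇒4∣⊎4∣2+ : ∀ {n} → 2 ∣ n → 4 ∣ n ⊎ 4 ∣ 2 + n
2∣⇒4∣⊎4∣2+ (divides k refl) = split k
  where
  split : ∀ k → 4 ∣ k * 2 ⊎ 4 ∣ 2 + k * 2
  split zero = inj₁ (divides 0 refl)
  split (suc k) = [ (λ 4∣2k → inj₂ (∣m∣n⇒∣m+n ∣-refl 4∣2k)) , inj₁ ]′ (split k)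

4∣⇒4∤2+ : ∀ {n} → 4 ∣ n → ¬ 4 ∣ 2 + n
4∣⇒4∤2+ {n} 4∣n 4∣2+n = 4∤2 (∣m+n∣m⇒∣n (subst (4 ∣_) (+-comm 2 n) 4∣2+n) 4∣n)

-- a = 1 + n is odd, a − 1 = n, a + 1 = 2 + n, and v = ν₂(a² − 1).
module OddSquare {n v : ℕ} (2∣n : 2 ∣ n) (ν : Val2 (n * (2 + n)) v) where

  ±1-bound : ∀ {k} → 2 ^ k ∣ n ⊎ 2 ^ k ∣ 2 + n → k ≤ v ∸ 1
  ±1-bound {k} 2^k∣n±1 = ∸-monoˡ-≤ 1 (Val2⇒≤ {e = v} ν 2^[1+k]∣)
    where
    2∣2+n : 2 ∣ 2 + n
    2∣2+n = ∣m∣n⇒∣m+n ∣-refl 2∣n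
    2^[1+k]∣ : 2 ^ suc k ∣ n * (2 + n)
    2^[1+k]∣ = [ (λ 2^k∣n → subst (_∣ n * (2 + n)) (*-comm (2 ^ k) 2) (*-pres-∣ 2^k∣n 2∣2+n))
               , *-pres-∣ 2∣n ]′ 2^k∣n±1

  1≤v∸1 : 1 ≤ v ∸ 1
  1≤v∸1 = ±1-bound (inj₁ 2∣n)

  2^[1+[v∸1]]∣ : 2 ^ suc (v ∸ 1) ∣ n * (2 + n)
  2^[1+[v∸1]]∣ = Val2⇒2^∣ {e = v} ν (≤-reflexive (m+[n∸m]≡n (≤-trans 1≤v∸1 (m∸n≤m v 1))))

  [1+n]²≡1 : ∀ {k} → k ≤ v ∸ 1 → suc n * suc n ≡ 1 [mod 2 ^ suc k ]
  [1+n]²≡1 k≤v∸1 with ∣-trans (m^n∣m^o 2 (s≤s k≤v∸1)) 2^[1+[v∸1]]∣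
  ... | divides q eq = q , trans ([1+n]²≡1+n*[2+n] n) (cong (1 +_) eq)

  4∣n⇒2^[v∸1]∣n : 4 ∣ n → 2 ^ (v ∸ 1) ∣ n
  4∣n⇒2^[v∸1]∣n 4∣n = 4∤m⇒2^[1+k]∣m*o⇒2^k∣o (v ∸ 1) (4∣⇒4∤2+ 4∣n)
    (subst (2 ^ suc (v ∸ 1) ∣_) (*-comm n (2 + n)) 2^[1+[v∸1]]∣)

  4∣2+n⇒2^[v∸1]∣2+n : 4 ∣ 2 + n → 2 ^ (v ∸ 1) ∣ 2 + n
  4∣2+n⇒2^[v∸1]∣2+n 4∣2+n = 4∤m⇒2^[1+k]∣m*o⇒2^k∣o (v ∸ 1) (λ 4∣n → 4∣⇒4∤2+ 4∣n 4∣2+n) 2^[1+[v∸1]]∣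

a+b≡[a+1]+[b-1] : ∀ n n′ → n + (2 + n′) ≡ 2 + n + n′
a+b≡[a+1]+[b-1] = solve-∀

Val2-[1+n]²∸1 : ∀ {n v} → Val2 (suc n * suc n ∸ 1) v → Val2 (n * (2 + n)) v
Val2-[1+n]²∸1 {n} {v} = subst (λ A → Val2 A v) (cong (_∸ 1) ([1+n]²≡1+n*[2+n] n))

ParitiesDiffer : ℕ → ℕ → ℕ → ℕ → Set
ParitiesDiffer x y x′ y′ = x % 2 ≢ x′ % 2 ⊎ y % 2 ≢ y′ % 2

module TwoOddBases {n n′ va vb : ℕ} (2∣n : 2 ∣ n) (2∣n′ : 2 ∣ n′)
  (νa : Val2 (n * (2 + n)) va) (νb : Val2 (n′ * (2 + n′)) vb) where

  private
    module A = OddSquare {n} {va} 2∣n νa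
    module B = OddSquare {n′} {vb} 2∣n′ νb

  N : ℕ
  N = (va ∸ 1) ⊓ (vb ∸ 1)

  m : ℕ
  m = 2 ^ suc N

  N≤va∸1 : N ≤ va ∸ 1
  N≤va∸1 = m⊓n≤m (va ∸ 1) (vb ∸ 1)

  N≤vb∸1 : N ≤ vb ∸ 1
  N≤vb∸1 = m⊓n≤n (va ∸ 1) (vb ∸ 1)

  1≤N : 1 ≤ N
  1≤N = ⊓-glb A.1≤v∸1 B.1≤v∸1

  m∤2 : ¬ m ∣ 2
  m∤2 m∣2 with ≤-trans (s≤s 1≤N) (Val2⇒≤ {2} {1} Val2-2 m∣2)
  ... | s≤s ()

  not-both-±1 : m ∣ n ⊎ m ∣ 2 + n → m ∣ n′ ⊎ m ∣ 2 + n′ → ⊥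
  not-both-±1 a≡±1 b≡±1 = n≮n N (⊓-glb (A.±1-bound a≡±1) (B.±1-bound b≡±1))

  ρ : ℕ → ℕ → ℕ
  ρ zero    zero    = 2
  ρ (suc _) zero    = 2 + n
  ρ zero    (suc _) = 2 + n′
  ρ (suc _) (suc _) = n + (2 + n′)

  ^+^≡ρ : ∀ r s → r < 2 → s < 2 → suc n ^ r + suc n′ ^ s ≡ ρ r s
  ^+^≡ρ 0 0 _ _ = refl
  ^+^≡ρ 1 0 _ _ = eq₁₀ n
    where
    eq₁₀ : ∀ n → (1 + n) * 1 + 1 ≡ 2 + n
    eq₁₀ = solve-∀
  ^+^≡ρ 0 1 _ _ = eq₀₁ n′
    where
    eq₀₁ : ∀ n′ → 1 + (1 + n′) * 1 ≡ 2 + n′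
    eq₀₁ = solve-∀
  ^+^≡ρ 1 1 _ _ = eq₁₁ n n′
    where
    eq₁₁ : ∀ n n′ → (1 + n) * 1 + (1 + n′) * 1 ≡ n + (2 + n′)
    eq₁₁ = solve-∀
  ^+^≡ρ (suc (suc _)) _ (s≤s (s≤s ())) _
  ^+^≡ρ _ (suc (suc _)) _ (s≤s (s≤s ()))

  sum≡ρ : ∀ x y → suc n ^ x + suc n′ ^ y ≡ ρ (x % 2) (y % 2) [mod m ]
  sum≡ρ x y = subst (λ r → suc n ^ x + suc n′ ^ y ≡ r [mod m ])
    (^+^≡ρ (x % 2) (y % 2) (m%n<n x 2) (m%n<n y 2))
    (+-≡[mod] (^≡^%2 (A.[1+n]²≡1 N≤va∸1) x) (^≡^%2 (B.[1+n]²≡1 N≤vb∸1) y))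

  a-part : ∀ {k} → 2 ^ (va ∸ 1) ∣ k → 2 ^ N ∣ k
  a-part = ∣-trans (m^n∣m^o 2 N≤va∸1)

  b-part : ∀ {k} → 2 ^ (vb ∸ 1) ∣ k → 2 ^ N ∣ k
  b-part = ∣-trans (m^n∣m^o 2 N≤vb∸1)

  b-1∣ : ∀ {d} → d ∣ n + (2 + n′) → d ∣ 2 + n → d ∣ n′
  b-1∣ {d} d∣a+b d∣a+1 = ∣m+n∣m⇒∣n (subst (d ∣_) (a+b≡[a+1]+[b-1] n n′) d∣a+b) d∣a+1

  a-1∣ : ∀ {d} → d ∣ n + (2 + n′) → d ∣ 2 + n′ → d ∣ n
  a-1∣ {d} d∣a+b d∣b+1 = ∣m+n∣m⇒∣n (subst (d ∣_) (+-comm n (2 + n′)) d∣a+b) d∣b+1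

  ρ-injective : ∀ r s r′ s′ → r < 2 → s < 2 → r′ < 2 → s′ < 2 →
    m ∣ ρ r s → m ∣ ρ r′ s′ → r ≡ r′ × s ≡ s′
  ρ-injective (suc (suc _)) _ _ _ (s≤s (s≤s ())) _ _ _ _ _
  ρ-injective _ (suc (suc _)) _ _ _ (s≤s (s≤s ())) _ _ _ _
  ρ-injective _ _ (suc (suc _)) _ _ _ (s≤s (s≤s ())) _ _ _
  ρ-injective _ _ _ (suc (suc _)) _ _ _ (s≤s (s≤s ())) _ _
  ρ-injective 0 0 _ _ _ _ _ _ m∣2 _ = ⊥-elim (m∤2 m∣2)
  ρ-injective _ _ 0 0 _ _ _ _ _ m∣2 = ⊥-elim (m∤2 m∣2)
  ρ-injective 1 0 1 0 _ _ _ _ _ _ = refl , refl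
  ρ-injective 0 1 0 1 _ _ _ _ _ _ = refl , refl
  ρ-injective 1 1 1 1 _ _ _ _ _ _ = refl , refl
  ρ-injective 1 0 0 1 _ _ _ _ m∣a+1 m∣b+1 = ⊥-elim (not-both-±1 (inj₂ m∣a+1) (inj₂ m∣b+1))
  ρ-injective 0 1 1 0 _ _ _ _ m∣b+1 m∣a+1 = ⊥-elim (not-both-±1 (inj₂ m∣a+1) (inj₂ m∣b+1))
  ρ-injective 1 0 1 1 _ _ _ _ m∣a+1 m∣a+b = ⊥-elim (not-both-±1 (inj₂ m∣a+1) (inj₁ (b-1∣ m∣a+b m∣a+1)))
  ρ-injective 1 1 1 0 _ _ _ _ m∣a+b m∣a+1 = ⊥-elim (not-both-±1 (inj₂ m∣a+1) (inj₁ (b-1∣ m∣a+b m∣a+1)))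
  ρ-injective 0 1 1 1 _ _ _ _ m∣b+1 m∣a+b = ⊥-elim (not-both-±1 (inj₁ (a-1∣ m∣a+b m∣b+1)) (inj₂ m∣b+1))
  ρ-injective 1 1 0 1 _ _ _ _ m∣a+b m∣b+1 = ⊥-elim (not-both-±1 (inj₁ (a-1∣ m∣a+b m∣b+1)) (inj₂ m∣b+1))

  4∣ρ⇒2^N∣ρ : ∀ r s → 4 ∣ ρ r s → 2 ^ N ∣ ρ r s
  4∣ρ⇒2^N∣ρ zero    zero    4∣2 = ⊥-elim (4∤2 4∣2)
  4∣ρ⇒2^N∣ρ (suc _) zero    4∣a+1 = a-part (A.4∣2+n⇒2^[v∸1]∣2+n 4∣a+1)
  4∣ρ⇒2^N∣ρ zero    (suc _) 4∣b+1 = b-part (B.4∣2+n⇒2^[v∸1]∣2+n 4∣b+1)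
  4∣ρ⇒2^N∣ρ (suc _) (suc _) 4∣a+b with 2∣⇒4∣⊎4∣2+ 2∣n
  ... | inj₁ 4∣a-1 = ∣m∣n⇒∣m+n (a-part (A.4∣n⇒2^[v∸1]∣n 4∣a-1))
                                (b-part (B.4∣2+n⇒2^[v∸1]∣2+n (∣m+n∣m⇒∣n 4∣a+b 4∣a-1)))
  ... | inj₂ 4∣a+1 = subst (2 ^ N ∣_) (sym (a+b≡[a+1]+[b-1] n n′))
    (∣m∣n⇒∣m+n (a-part (A.4∣2+n⇒2^[v∸1]∣2+n 4∣a+1))
               (b-part (B.4∣n⇒2^[v∸1]∣n (b-1∣ 4∣a+b 4∣a+1))))

  4∣sum⇒2^N∣sum : ∀ x y → 4 ∣ suc n ^ x + suc n′ ^ y → 2 ^ N ∣ suc n ^ x + suc n′ ^ y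
  4∣sum⇒2^N∣sum x y 4∣S = ≡[mod]∧∣⇐∣ (m^n∣m^o 2 (n≤1+n N)) (sum≡ρ x y)
    (4∣ρ⇒2^N∣ρ (x % 2) (y % 2) (≡[mod]∧∣⇒∣ (m^n∣m^o 2 (s≤s 1≤N)) (sum≡ρ x y) 4∣S))

  m∣sum⇒same-parities : ∀ x y x′ y′ → m ∣ suc n ^ x + suc n′ ^ y → m ∣ suc n ^ x′ + suc n′ ^ y′ →
    ¬ ParitiesDiffer x y x′ y′
  m∣sum⇒same-parities x y x′ y′ m∣S m∣S′
    with ρ-injective (x % 2) (y % 2) (x′ % 2) (y′ % 2)
           (m%n<n x 2) (m%n<n y 2) (m%n<n x′ 2) (m%n<n y′ 2)
           (≡[mod]∧∣⇒∣ ∣-refl (sum≡ρ x y) m∣S) (≡[mod]∧∣⇒∣ ∣-refl (sum≡ρ x′ y′) m∣S′)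
  ... | same-x , same-y = [ (λ x≢x′ → x≢x′ same-x) , (λ y≢y′ → y≢y′ same-y) ]′

  N≤ν₂[sum] : ∀ {x y S e} → suc n ^ x + suc n′ ^ y ≡ S → Val2 S e → 2 ≤ e → N ≤ e
  N≤ν₂[sum] {x} {y} {S} {e} refl νS 2≤e =
    Val2⇒≤ {S} {e} νS (4∣sum⇒2^N∣sum x y (Val2⇒2^∣ {S} {e} νS 2≤e))

  three-solutions : ∀ {c β} x₁ y₁ z₁ x₂ y₂ z₂ x₃ y₃ z₃ → 2 ∣ c → Val2 c β → 1 ≤ z₁ →
    suc n ^ x₁ + suc n′ ^ y₁ ≡ c ^ z₁ → suc n ^ x₂ + suc n′ ^ y₂ ≡ c ^ z₂ →
    suc n ^ x₃ + suc n′ ^ y₃ ≡ c ^ z₃ → z₁ ≤ z₂ → z₂ ≤ z₃ →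
    ParitiesDiffer x₁ y₁ x₂ y₂ ⊎ ParitiesDiffer x₁ y₁ x₃ y₃ ⊎ ParitiesDiffer x₂ y₂ x₃ y₃ →
    (β ≡ 1 × z₁ ≡ 1) ⊎ z₁ * β ≡ N
  three-solutions {c} {β} x₁ y₁ z₁ x₂ y₂ z₂ x₃ y₃ z₃ 2∣c νc 1≤z₁ e₁ e₂ e₃ z₁≤z₂ z₂≤z₃ differ
    with 2 ≤? z₁ * β
  ... | no z₁β≱2 = inj₁ (m*n≡1⇒n≡1 z₁ β z₁β≡1 , m*n≡1⇒m≡1 z₁ β z₁β≡1)
    where
    z₁β≡1 : z₁ * β ≡ 1
    z₁β≡1 = ≤-antisym (≤-pred (≰⇒> z₁β≱2)) (*-mono-≤ 1≤z₁ (Val2⇒≤ {c} {β} {1} νc 2∣c))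
  ... | yes 2≤z₁β = inj₂ (≤-antisym (≮⇒≥ N≮z₁β) (N≤ν₂[sum] {x₁} {y₁} e₁ (Val2-^ νc z₁) 2≤z₁β))
    where
    N≮z₁β : ¬ N < z₁ * β
    N≮z₁β N<z₁β = [ m∣sum⇒same-parities x₁ y₁ x₂ y₂ (m∣ ≤-refl e₁) (m∣ z₁≤z₂ e₂)
                  , [ m∣sum⇒same-parities x₁ y₁ x₃ y₃ (m∣ ≤-refl e₁) (m∣ z₁≤z₃ e₃)
                    , m∣sum⇒same-parities x₂ y₂ x₃ y₃ (m∣ z₁≤z₂ e₂) (m∣ z₁≤z₃ e₃) ]′ ]′ differ
      where
      z₁≤z₃ : z₁ ≤ z₃
      z₁≤z₃ = ≤-trans z₁≤z₂ z₂≤z₃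
      m∣ : ∀ {S z} → z₁ ≤ z → S ≡ c ^ z → m ∣ S
      m∣ {z = z} z₁≤z e = subst (m ∣_) (sym e)
        (Val2⇒2^∣ {c ^ z} {z * β} (Val2-^ νc z) (≤-trans N<z₁β (*-monoˡ-≤ β z₁≤z)))

lemma5p4 : (a b c : ℕ) → 1 ≤ a → 1 ≤ b → 1 ≤ c →
    ¬ IsPerfectPower a → ¬ IsPerfectPower b → ¬ IsPerfectPower c →
    Coprime a b → Coprime b c → Coprime a c →
    (a % 4 ≡ 3 ⊎ b % 4 ≡ 3) →
    11 ≤ a ⊔ b →
    18 ≤ a ⊔ b ⊔ c → a ⊔ b ⊔ c ≤ 10 ^ 62 →
    2 ∣ c → 2 < c →
    (va vb β : ℕ) → Val2 (a * a ∸ 1) va → Val2 (b * b ∸ 1) vb → Val2 c β →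
    (x₁ y₁ z₁ x₂ y₂ z₂ x₃ y₃ z₃ : ℕ) →
    1 ≤ x₁ → 1 ≤ y₁ → 1 ≤ z₁ → 1 ≤ x₂ → 1 ≤ y₂ → 1 ≤ z₂ →
    1 ≤ x₃ → 1 ≤ y₃ → 1 ≤ z₃ →
    a ^ x₁ + b ^ y₁ ≡ c ^ z₁ → a ^ x₂ + b ^ y₂ ≡ c ^ z₂ →
    a ^ x₃ + b ^ y₃ ≡ c ^ z₃ →
    (x₁ , y₁ , z₁) ≢ (x₂ , y₂ , z₂) → (x₁ , y₁ , z₁) ≢ (x₃ , y₃ , z₃) →
    (x₂ , y₂ , z₂) ≢ (x₃ , y₃ , z₃) →
    z₁ ≤ z₂ → z₂ ≤ z₃ →
    ((x₁ % 2 ≢ x₂ % 2 ⊎ y₁ % 2 ≢ y₂ % 2) ⊎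
     (x₁ % 2 ≢ x₃ % 2 ⊎ y₁ % 2 ≢ y₃ % 2) ⊎
     (x₂ % 2 ≢ x₃ % 2 ⊎ y₂ % 2 ≢ y₃ % 2)) →
    (β ≡ 1 × z₁ ≡ 1) ⊎ z₁ * β ≡ (va ∸ 1) ⊓ (vb ∸ 1)
lemma5p4 a b c _ _ _ _ _ _ _ b⊥c a⊥c _ _ _ _ 2∣c _ va vb β νa νb νc
  x₁ y₁ z₁ x₂ y₂ z₂ x₃ y₃ z₃ _ _ 1≤z₁ _ _ _ _ _ _ e₁ e₂ e₃ _ _ _ z₁≤z₂ z₂≤z₃ differ
  with 2∤⇒suc-even a (coprime∧2∣⇒2∤ a⊥c 2∣c) | 2∤⇒suc-even b (coprime∧2∣⇒2∤ b⊥c 2∣c)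
... | n , refl , 2∣n | n′ , refl , 2∣n′ =
  TwoOddBases.three-solutions {n} {n′} {va} {vb} 2∣n 2∣n′ (Val2-[1+n]²∸1 {n} {va} νa) (Val2-[1+n]²∸1 {n′} {vb} νb)
    x₁ y₁ z₁ x₂ y₂ z₂ x₃ y₃ z₃ 2∣c νc 1≤z₁ e₁ e₂ e₃ z₁≤z₂ z₂≤z₃ differ
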